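{- Let $H=(U,V,E)\sim B(k,n-k,1/2)$. Then, for any $r\le|U|$, with probability at least $0.99$ over the draw of $H$: (1) $H$ has $r$-fold balancedness $O(\sqrt{rn\log k})$, and (2) the maximum degree of a vertex in $V$ is at most $k/2+O(\sqrt{k\log n})$.
   Context: $B(n_1,n_2,p)$: bipartite graphs with left vertex set $U$, $|U|=n_1$, right vertex set $V$, $|V|=n_2$, each pair an edge independently with probability $p$. For a bipartite graph $H=(U,V,E)$ let $H(i,j)=1$ if $\{i,j\}\in E$ and $H(i,j)=-1$ otherwise. For $S\subseteq U$ let $u_S\in\{ -1,1\}^{V}$ be $u_S(j)=\prod_{i\in S}H(i,j)$. $H$ has $r$-fold balancedness $\Delta_r$ if $|\sum_{j\in V}u_S(j)|\le\Delta_r$ for all $S\subseteq U$ with $|S|\le r$. $O(f)$ denotes a sufficiently large absolute constant times $f$. -}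

module Defs where

open import Data.Bool using (Bool; true; false; if_then_else_)
open import Data.Nat using (ℕ; zero; suc; _+_; _*_; _≤_; _^_)
open import Data.Integer as ℤ using (ℤ; +_; -[1+_])
open import Data.Fin using (Fin)
open import Data.Fin.Subset using (Subset; ∣_∣)
open import Data.Vec using (Vec; lookup)
open import Data.List using (List; []; _∷_; foldr; allFin; concatMap; map; length)
open import Data.List.Relation.Unary.All using (All)
open import Data.List.Relation.Unary.Unique.Propositional using (Unique)
open import Data.Product using (Σ; ∃; _×_)
open import Data.Nat.Logarithm using (⌈log₂_⌉)

-- A bipartite graph with left part U = Fin k and right part V = Fin m:
-- G i j = true iff {i,j} is an edge.
BipGraph : ℕ → ℕ → Set
BipGraph k m = Vec (Vec Bool m) k

edge : ∀ {k m} → BipGraph k m → Fin k → Fin m → Bool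
edge G i j = lookup (lookup G i) j

H : ∀ {k m} → BipGraph k m → Fin k → Fin m → ℤ
H G i j = if edge G i j then + 1 else -[1+ 0 ]

u : ∀ {k m} → BipGraph k m → Subset k → Fin m → ℤ
u {k} G S j = foldr (λ i acc → (if lookup S i then H G i j else + 1) ℤ.* acc) (+ 1) (allFin k)

sumU : ∀ {k m} → BipGraph k m → Subset k → ℤ
sumU {k} {m} G S = foldr (λ j acc → u G S j ℤ.+ acc) (+ 0) (allFin m)

HasBalancedness : ∀ {k m} → BipGraph k m → ℕ → ℕ → Set
HasBalancedness {k} G r Δ =
  (S : Subset k) → 1 ≤ ∣ S ∣ → ∣ S ∣ ≤ r → ℤ.∣ sumU G S ∣ ≤ Δ

degV : ∀ {k m} → BipGraph k m → Fin m → ℕ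
degV {k} G j = foldr (λ i acc → if edge G i j then suc acc else acc) 0 (allFin k)

-- "Pr_{H ~ B(k,m,1/2)}[ P H ] ≥ a/b": since p = 1/2 is the uniform distribution
-- on the 2^(k*m) graphs, this says there are at least (a/b)·2^(k*m) distinct
-- graphs satisfying P.
ProbAtLeast : (k m : ℕ) → (BipGraph k m → Set) → ℕ → ℕ → Set
ProbAtLeast k m P a b =
  Σ (List (BipGraph k m)) λ Gs → Unique Gs × All P Gs × (a * 2 ^ (k * m) ≤ b * length Gs)

-- logarithm convention: log x read as ⌈log₂ (x+1)⌉ (constant factors absorbed by O)
lg : ℕ → ℕ
lg x = ⌈log₂ (suc x) ⌉

-- Since p = 1/2, probabilities are counts over all 2^(km) graphs, and both claims follow from an
-- exponential-moment (Chernoff) bound that can be carried out exactly in ℕ. A ±1 sequence with p plus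
-- and q minus entries gets the weight up^p · down^q, where up, down = mid ± 1 and mid = 2M + 2. The
-- entries of a column of H, and the values u_S(j) for S ≠ ∅, are independent fair signs, so these
-- weights sum to exactly 2^(km) · mid^n over all graphs. Choosing mid² ≈ n/Q, Bernoulli-type
-- inequalities show that a drift p − q > Δ with Δ² = O(Qn) forces a weight ≥ 2^(Q+9) · mid^n.
-- Markov's inequality and a union bound over at most 2^Q tests (the ≤ (k+1)^r sets S, with
-- Q = r · lg k, or the m right vertices, with Q = lg (k + m)) leave at most 1/200 of the graphs
-- bad for each claim, hence 99/100 for both.

module Submission where

open import Defs
open import Data.Bool using (Bool; true; false; if_then_else_; not; _∧_)
open import Data.Nat
open import Data.Nat.Properties
open import Data.Nat.Induction using (<-wellFounded)
open import Data.Nat.Logarithm using (⌈log₂_⌉)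
open import Data.Nat.Logarithm.Core using (⌈log2⌉)
open import Data.Nat.Tactic.RingSolver using (solve-∀)
open import Data.Integer as ℤ using (ℤ; -[1+_])
import Data.Integer.Properties as ℤ
import Data.Integer.Tactic.RingSolver as ℤ-Solver
open import Data.Fin using (Fin; zero; suc)
open import Data.Fin.Subset using (Subset; ∣_∣)
open import Data.Vec using (Vec; []; _∷_; lookup)
import Data.Vec.Properties as Vec
open import Data.List using (List; []; _∷_; _++_; map; foldr; length; allFin; filter; cartesianProductWith)
open import Data.List.Properties using (length-++; length-map; length-tabulate; map-tabulate; foldr-map; length-filter; filter-none)
open import Data.List.Membership.Propositional using (_∈_; find)
open import Data.List.Membership.Propositional.Properties using (∈-map⁺; ∈-++⁺ˡ; ∈-++⁺ʳ; ∈-filter⁺; ∈-allFin)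
open import Data.List.Relation.Unary.Any using (here; there)
open import Data.List.Relation.Unary.All as All using (All; []; _∷_; all?)
open import Data.List.Relation.Unary.All.Properties using (all-filter; ¬All⇒Any¬)
import Data.List.Relation.Unary.AllPairs as AllPairs
open import Data.List.Relation.Unary.Unique.Propositional using (Unique)
import Data.List.Relation.Unary.Unique.Propositional.Properties as Unique
open import Data.Product using (Σ; _,_; _×_)
open import Data.Sum using (_⊎_; inj₁; inj₂)
open import Data.Unit using (⊤; tt)
open import Function using (_∘_)
open import Induction.WellFounded using (Acc; acc)
open import Relation.Binary.PropositionalEquality
open import Relation.Nullary using (¬_; ¬?; yes; no; contradiction; _×-dec_)
open import Relation.Unary using (Pred; Decidable)

^-distribʳ-* : ∀ m n o → (m * n) ^ o ≡ m ^ o * n ^ o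
^-distribʳ-* m n zero    = refl
^-distribʳ-* m n (suc o) = begin
  m * n * (m * n) ^ o     ≡⟨ cong (m * n *_) (^-distribʳ-* m n o) ⟩
  m * n * (m ^ o * n ^ o) ≡⟨ interchange m n (m ^ o) (n ^ o) ⟩
  m * m ^ o * (n * n ^ o) ∎
  where
  open ≡-Reasoning
  interchange : ∀ a b c d → a * b * (c * d) ≡ a * c * (b * d)
  interchange = solve-∀

m≤k*n⇒m^c≤k^c*n^c : ∀ {m n} k c → m ≤ k * n → m ^ c ≤ k ^ c * n ^ c
m≤k*n⇒m^c≤k^c*n^c {n = n} k c m≤kn = ≤-trans (^-monoˡ-≤ c m≤kn) (≤-reflexive (^-distribʳ-* k n c))

k*n≤m⇒k^c*n^c≤m^c : ∀ {m n} k c → k * n ≤ m → k ^ c * n ^ c ≤ m ^ c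
k*n≤m⇒k^c*n^c≤m^c {n = n} k c kn≤m = ≤-trans (≤-reflexive (sym (^-distribʳ-* k n c))) (^-monoˡ-≤ c kn≤m)

-- (1 + 1/x)^n ≥ 1 + n/x, multiplied out.
bernoulli : ∀ x n → x ^ n * (x + n) ≤ x * suc x ^ n
bernoulli x zero    = ≤-reflexive (base x)
  where
  base : ∀ x → 1 * (x + 0) ≡ x * 1
  base = solve-∀
bernoulli x (suc n) = begin
  x * x ^ n * (x + suc n)              ≤⟨ m≤m+n _ _ ⟩
  x * x ^ n * (x + suc n) + x ^ n * n  ≡⟨ expand x n (x ^ n) ⟩
  suc x * (x ^ n * (x + n))            ≤⟨ *-monoʳ-≤ (suc x) (bernoulli x n) ⟩
  suc x * (x * suc x ^ n)              ≡⟨ *-comm-mid x (suc x ^ n) ⟩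
  x * (suc x * suc x ^ n)              ∎
  where
  open ≤-Reasoning
  expand : ∀ x n p → x * p * (x + suc n) + p * n ≡ suc x * (p * (x + n))
  expand = solve-∀
  *-comm-mid : ∀ x p → suc x * (x * p) ≡ x * (suc x * p)
  *-comm-mid = solve-∀

-- (1 + 1/x)^n · (1 − n/(1 + x)) ≤ 1, multiplied out.
reverseBernoulli : ∀ x n → suc x ^ n * suc x ≤ x ^ n * suc x + n * suc x ^ n
reverseBernoulli x zero    = ≤-reflexive (base x)
  where
  base : ∀ x → 1 * suc x ≡ 1 * suc x + 0 * 1
  base = solve-∀
reverseBernoulli x (suc n) = begin
  suc x * suc x ^ n * suc x                              ≡⟨ reassoc x (suc x ^ n) ⟩
  suc x * (suc x ^ n * suc x)                            ≤⟨ *-monoʳ-≤ (suc x) (reverseBernoulli x n) ⟩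
  suc x * (x ^ n * suc x + n * suc x ^ n)                ≡⟨ expand x n (x ^ n) (suc x ^ n) ⟩
  x * x ^ n * suc x + x ^ n * suc x + n * suc x ^ (suc n) ≤⟨ +-monoˡ-≤ (n * suc x ^ suc n) (+-monoʳ-≤ (x * x ^ n * suc x) x^n*[1+x]≤[1+x]^[1+n]) ⟩
  x * x ^ n * suc x + suc x ^ suc n + n * suc x ^ suc n  ≡⟨ +-assoc (x * x ^ n * suc x) (suc x ^ suc n) (n * suc x ^ suc n) ⟩
  x * x ^ n * suc x + suc n * suc x ^ suc n              ∎
  where
  open ≤-Reasoning
  reassoc : ∀ x p → suc x * p * suc x ≡ suc x * (p * suc x)
  reassoc = solve-∀
  expand : ∀ x n p q → suc x * (p * suc x + n * q) ≡ x * p * suc x + p * suc x + n * (suc x * q)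
  expand = solve-∀
  x^n*[1+x]≤[1+x]^[1+n] : x ^ n * suc x ≤ suc x ^ suc n
  x^n*[1+x]≤[1+x]^[1+n] = ≤-trans (*-monoˡ-≤ (suc x) (^-monoˡ-≤ n (n≤1+n x))) (≤-reflexive (*-comm _ (suc x)))

[1+x]^h≤2*x^h : ∀ x h → suc x ≡ 2 * h → suc x ^ h ≤ 2 * x ^ h
[1+x]^h≤2*x^h x h 1+x≡2h = *-cancelʳ-≤ _ _ (suc x) (+-cancelʳ-≤ (suc x * suc x ^ h) _ _ (begin
  suc x ^ h * suc x + suc x * suc x ^ h      ≡⟨ double (suc x ^ h) x ⟩
  2 * (suc x ^ h * suc x)                    ≤⟨ *-monoʳ-≤ 2 (reverseBernoulli x h) ⟩
  2 * (x ^ h * suc x + h * suc x ^ h)        ≡⟨ distrib (x ^ h) x h (suc x ^ h) ⟩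
  2 * x ^ h * suc x + 2 * h * suc x ^ h      ≡⟨ cong (λ z → 2 * x ^ h * suc x + z * suc x ^ h) (sym 1+x≡2h) ⟩
  2 * x ^ h * suc x + suc x * suc x ^ h      ∎))
  where
  open ≤-Reasoning
  double : ∀ p x → p * suc x + suc x * p ≡ 2 * (p * suc x)
  double = solve-∀
  distrib : ∀ p x h q → 2 * (p * suc x + h * q) ≡ 2 * p * suc x + 2 * h * q
  distrib = solve-∀

2*x^x≤[1+x]^x : ∀ x .{{_ : NonZero x}} → 2 * x ^ x ≤ suc x ^ x
2*x^x≤[1+x]^x x@(suc _) = *-cancelˡ-≤ x (begin
  x * (2 * x ^ x) ≡⟨ rearrange x (x ^ x) ⟩
  x ^ x * (x + x) ≤⟨ bernoulli x x ⟩
  x * suc x ^ x   ∎)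
  where
  open ≤-Reasoning
  rearrange : ∀ x p → x * (2 * p) ≡ p * (x + x)
  rearrange = solve-∀

-- The ratio (1 + y)^n / y^n is nondecreasing in n.
[1+y]^n≤k*y^n⇒[1+y]^q≤k*y^q : ∀ y k {q n} → q ≤ n → suc y ^ n ≤ k * y ^ n → suc y ^ q ≤ k * y ^ q
[1+y]^n≤k*y^n⇒[1+y]^q≤k*y^q y k {q} {n} q≤n bound =
  *-cancelʳ-≤ _ _ (suc y ^ s) {{m^n≢0 (suc y) s}} (begin
    suc y ^ q * suc y ^ s ≡⟨ sym (^-distribˡ-+-* (suc y) q s) ⟩
    suc y ^ (q + s)       ≡⟨ cong (suc y ^_) q+s≡n ⟩
    suc y ^ n             ≤⟨ bound ⟩
    k * y ^ n             ≡⟨ cong (λ e → k * y ^ e) (sym q+s≡n) ⟩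
    k * y ^ (q + s)       ≡⟨ cong (k *_) (^-distribˡ-+-* y q s) ⟩
    k * (y ^ q * y ^ s)   ≡⟨ sym (*-assoc k (y ^ q) (y ^ s)) ⟩
    k * y ^ q * y ^ s     ≤⟨ *-monoʳ-≤ (k * y ^ q) (^-monoˡ-≤ s (n≤1+n y)) ⟩
    k * y ^ q * suc y ^ s ∎)
  where
  open ≤-Reasoning
  s = n ∸ q
  q+s≡n = m+[n∸m]≡n q≤n

k*y^n≤[1+y]^n⇒k*y^d≤[1+y]^d : ∀ y k {n d} → n ≤ d → k * y ^ n ≤ suc y ^ n → k * y ^ d ≤ suc y ^ d
k*y^n≤[1+y]^n⇒k*y^d≤[1+y]^d y k {n} {d} n≤d bound = begin
  k * y ^ d               ≡⟨ cong (λ e → k * y ^ e) (sym n+s≡d) ⟩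
  k * y ^ (n + s)         ≡⟨ cong (k *_) (^-distribˡ-+-* y n s) ⟩
  k * (y ^ n * y ^ s)     ≡⟨ sym (*-assoc k (y ^ n) (y ^ s)) ⟩
  k * y ^ n * y ^ s       ≤⟨ *-mono-≤ bound (^-monoˡ-≤ s (n≤1+n y)) ⟩
  suc y ^ n * suc y ^ s   ≡⟨ sym (^-distribˡ-+-* (suc y) n s) ⟩
  suc y ^ (n + s)         ≡⟨ cong (suc y ^_) n+s≡d ⟩
  suc y ^ d               ∎
  where
  open ≤-Reasoning
  s = d ∸ n
  n+s≡d = m+[n∸m]≡n n≤d

[1+x]^q≤2^c*x^q : ∀ x h c {q} → suc x ≡ 2 * h → q ≤ h * c → suc x ^ q ≤ 2 ^ c * x ^ q
[1+x]^q≤2^c*x^q x h c 1+x≡2h q≤hc = [1+y]^n≤k*y^n⇒[1+y]^q≤k*y^q x (2 ^ c) q≤hc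
  (subst₂ (λ s t → s ≤ 2 ^ c * t) (^-*-assoc (suc x) h c) (^-*-assoc x h c)
    (m≤k*n⇒m^c≤k^c*n^c 2 c ([1+x]^h≤2*x^h x h 1+x≡2h)))

2^c*x^d≤[1+x]^d : ∀ x c {d} .{{_ : NonZero x}} → x * c ≤ d → 2 ^ c * x ^ d ≤ suc x ^ d
2^c*x^d≤[1+x]^d x c xc≤d = k*y^n≤[1+y]^n⇒k*y^d≤[1+y]^d x (2 ^ c) xc≤d
  (subst₂ (λ s t → 2 ^ c * s ≤ t) (^-*-assoc x x c) (^-*-assoc (suc x) x c)
    (k*n≤m⇒k^c*n^c≤m^c 2 c (2*x^x≤[1+x]^x x)))

n≤2^⌈log₂n⌉ : ∀ n → n ≤ 2 ^ ⌈log₂ n ⌉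
n≤2^⌈log₂n⌉ n = go n (<-wellFounded n)
  where
  go : ∀ n (rec : Acc _<_ n) → n ≤ 2 ^ ⌈log2⌉ n rec
  go zero          _         = z≤n
  go (suc zero)    _         = s≤s z≤n
  go (suc (suc n)) (acc rec) = ≤-trans 2+n≤2[1+⌈n/2⌉] (*-monoʳ-≤ 2 (go (suc ⌈ n /2⌉) (rec (⌈n/2⌉<n n))))
    where
    n≤2⌈n/2⌉ : n ≤ ⌈ n /2⌉ + ⌈ n /2⌉
    n≤2⌈n/2⌉ = ≤-trans (≤-reflexive (sym (⌊n/2⌋+⌈n/2⌉≡n n))) (+-monoˡ-≤ _ (⌊n/2⌋≤⌈n/2⌉ n))
    2+n≤2[1+⌈n/2⌉] : 2 + n ≤ 2 * suc ⌈ n /2⌉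
    2+n≤2[1+⌈n/2⌉] = ≤-trans (s≤s (s≤s n≤2⌈n/2⌉)) (≤-reflexive (double ⌈ n /2⌉))
      where
      double : ∀ c → 2 + (c + c) ≡ 2 * suc c
      double = solve-∀

n<2^lg : ∀ n → n < 2 ^ lg n
n<2^lg n = n≤2^⌈log₂n⌉ (suc n)

1<2^l⇒1≤l : ∀ {l} → 1 < 2 ^ l → 1 ≤ l
1<2^l⇒1≤l {zero}  (s≤s ())
1<2^l⇒1≤l {suc l} _ = s≤s z≤n

-- An exponential tail bound

mid up down : ℕ → ℕ
mid M  = 2 + 2 * M
up M   = 3 + 2 * M
down M = 1 + 2 * M

up+down≡2*mid : ∀ M → up M + down M ≡ 2 * mid M
up+down≡2*mid M = lemma M
  where
  lemma : ∀ M → (3 + 2 * M) + (1 + 2 * M) ≡ 2 * (2 + 2 * M)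
  lemma = solve-∀

up*down+1≡mid*mid : ∀ M → suc (up M * down M) ≡ mid M * mid M
up*down+1≡mid*mid = lemma
  where
  lemma : ∀ M → suc ((3 + 2 * M) * (1 + 2 * M)) ≡ (2 + 2 * M) * (2 + 2 * M)
  lemma = solve-∀

up*down+1≡2*[2[1+M]²] : ∀ M → suc (up M * down M) ≡ 2 * (2 * (suc M * suc M))
up*down+1≡2*[2[1+M]²] = lemma
  where
  lemma : ∀ M → suc ((3 + 2 * M) * (1 + 2 * M)) ≡ 2 * (2 * (suc M * suc M))
  lemma = solve-∀

-- With q minus-steps and q + d plus-steps, write mid^(2q+d) = (up·down + 1)^q · mid^d and
-- compare the two factors with (up·down)^q and up^d separately.
2^[Q+9]*mid^[2q+d]≤up^[q+d]*down^q : ∀ M Q q d → q ≤ 2 * (suc M * suc M) * Q → mid M * (2 * Q + 9) ≤ d →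
  2 ^ (Q + 9) * mid M ^ ((q + d) + q) ≤ up M ^ (q + d) * down M ^ q
2^[Q+9]*mid^[2q+d]≤up^[q+d]*down^q M Q q d q≤hQ L[2Q+9]≤d = begin
  2 ^ (Q + 9) * L ^ ((q + d) + q)        ≡⟨ cong (2 ^ (Q + 9) *_) mid-split ⟩
  2 ^ (Q + 9) * (suc x ^ q * L ^ d)      ≤⟨ *-monoʳ-≤ (2 ^ (Q + 9)) (*-monoˡ-≤ (L ^ d) [1+x]^q≤) ⟩
  2 ^ (Q + 9) * (2 ^ Q * x ^ q * L ^ d)  ≡⟨ collect (2 ^ (Q + 9)) (2 ^ Q) (x ^ q) (L ^ d) ⟩
  x ^ q * (2 ^ (Q + 9) * 2 ^ Q * L ^ d)  ≡⟨ cong (λ z → x ^ q * (z * L ^ d)) 2^[Q+9]*2^Q≡2^[2Q+9] ⟩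
  x ^ q * (2 ^ (2 * Q + 9) * L ^ d)      ≤⟨ *-monoʳ-≤ (x ^ q) (2^c*x^d≤[1+x]^d L (2 * Q + 9) L[2Q+9]≤d) ⟩
  x ^ q * a ^ d                          ≡⟨ cong (_* a ^ d) (^-distribʳ-* a b q) ⟩
  a ^ q * b ^ q * a ^ d                  ≡⟨ regroup (a ^ q) (b ^ q) (a ^ d) ⟩
  a ^ q * a ^ d * b ^ q                  ≡⟨ cong (_* b ^ q) (sym (^-distribˡ-+-* a q d)) ⟩
  a ^ (q + d) * b ^ q                    ∎
  where
  open ≤-Reasoning
  L = mid M
  a = up M
  b = down M
  x = a * b
  [1+x]^q≤ : suc x ^ q ≤ 2 ^ Q * x ^ q
  [1+x]^q≤ = [1+x]^q≤2^c*x^q x (2 * (suc M * suc M)) Q (up*down+1≡2*[2[1+M]²] M) q≤hQ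
  mid-split : L ^ ((q + d) + q) ≡ suc x ^ q * L ^ d
  mid-split = begin-equality
    L ^ ((q + d) + q)   ≡⟨ cong (L ^_) (exponents q d) ⟩
    L ^ ((q + q) + d)   ≡⟨ ^-distribˡ-+-* L (q + q) d ⟩
    L ^ (q + q) * L ^ d ≡⟨ cong (_* L ^ d) (^-distribˡ-+-* L q q) ⟩
    L ^ q * L ^ q * L ^ d ≡⟨ cong (_* L ^ d) (sym (^-distribʳ-* L L q)) ⟩
    (L * L) ^ q * L ^ d ≡⟨ cong (λ z → z ^ q * L ^ d) (sym (up*down+1≡mid*mid M)) ⟩
    suc x ^ q * L ^ d   ∎
    where
    exponents : ∀ q d → (q + d) + q ≡ (q + q) + d
    exponents = solve-∀
  2^[Q+9]*2^Q≡2^[2Q+9] : 2 ^ (Q + 9) * 2 ^ Q ≡ 2 ^ (2 * Q + 9)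
  2^[Q+9]*2^Q≡2^[2Q+9] = trans (sym (^-distribˡ-+-* 2 (Q + 9) Q)) (cong (2 ^_) (exponent Q))
    where
    exponent : ∀ Q → Q + 9 + Q ≡ 2 * Q + 9
    exponent = solve-∀
  collect : ∀ A B C D → A * (B * C * D) ≡ C * (A * B * D)
  collect = solve-∀
  regroup : ∀ A B C → A * B * C ≡ A * C * B
  regroup = solve-∀

∃M[Q[1+M]²≤n≤Q·mid²] : ∀ n Q → 1 ≤ Q → Q ≤ n → Σ ℕ λ M → Q * (suc M * suc M) ≤ n × n ≤ Q * (mid M * mid M)
∃M[Q[1+M]²≤n≤Q·mid²] n Q 1≤Q Q≤n = search n n≤Q·mid[n]²
  where
  search : ∀ t → n ≤ Q * (mid t * mid t) → Σ ℕ λ M → Q * (suc M * suc M) ≤ n × n ≤ Q * (mid M * mid M)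
  search zero    n≤ = 0 , subst (_≤ n) (sym (*-identityʳ Q)) Q≤n , n≤
  search (suc t) n≤ with n ≤? Q * (mid t * mid t)
  ... | yes n≤′ = search t n≤′
  ... | no  n≰  = suc t , ≤-trans (*-monoʳ-≤ Q (*-mono-≤ 2+t≤mid[t] 2+t≤mid[t])) (<⇒≤ (≰⇒> n≰)) , n≤
    where
    2+t≤mid[t] : 2 + t ≤ mid t
    2+t≤mid[t] = +-monoʳ-≤ 2 (m≤n*m t 2)
  n≤Q·mid[n]² : n ≤ Q * (mid n * mid n)
  n≤Q·mid[n]² = ≤-trans (m≤n+m n 2) (≤-trans (+-monoʳ-≤ 2 (m≤n*m n 2))
    (≤-trans (m≤m*n (mid n) (mid n)) (m≤n*m _ Q {{>-nonZero 1≤Q}})))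

drift⇒2^[Q+9]*mid^n≤up^p*down^q : ∀ M Q n → n ≤ Q * (mid M * mid M) →
  ∀ p q → p + q ≡ n → q + (2 * Q + 9) * mid M < p → 2 ^ (Q + 9) * mid M ^ n ≤ up M ^ p * down M ^ q
drift⇒2^[Q+9]*mid^n≤up^p*down^q M Q n n≤Q·mid² p q p+q≡n q+Δ<p =
  subst₂ (λ s t → 2 ^ (Q + 9) * mid M ^ s ≤ up M ^ t * down M ^ q)
    (trans (cong (_+ q) q+d≡p) p+q≡n) q+d≡p
    (2^[Q+9]*mid^[2q+d]≤up^[q+d]*down^q M Q q d q≤hQ Δ≤d)
  where
  open ≤-Reasoning
  Δ = (2 * Q + 9) * mid M
  q≤p : q ≤ p
  q≤p = ≤-trans (m≤m+n q Δ) (<⇒≤ q+Δ<p)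
  d = p ∸ q
  q+d≡p : q + d ≡ p
  q+d≡p = m+[n∸m]≡n q≤p
  Δ≤d : mid M * (2 * Q + 9) ≤ d
  Δ≤d = ≤-trans (≤-reflexive (*-comm (mid M) (2 * Q + 9)))
    (m+n≤o⇒m≤o∸n Δ (≤-trans (≤-reflexive (+-comm Δ q)) (<⇒≤ q+Δ<p)))
  q≤hQ : q ≤ 2 * (suc M * suc M) * Q
  q≤hQ = *-cancelˡ-≤ 2 (begin
    2 * q                               ≡⟨ cong (q +_) (+-identityʳ q) ⟩
    q + q                               ≤⟨ +-monoˡ-≤ q q≤p ⟩
    p + q                               ≡⟨ p+q≡n ⟩
    n                                   ≤⟨ n≤Q·mid² ⟩
    Q * (mid M * mid M)                 ≡⟨ rearrange Q M ⟩
    2 * (2 * (suc M * suc M) * Q)       ∎)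
    where
    rearrange : ∀ Q M → Q * ((2 + 2 * M) * (2 + 2 * M)) ≡ 2 * (2 * (suc M * suc M) * Q)
    rearrange = solve-∀

record ExponentialTail (n Q : ℕ) : Set where
  field
    M Δ : ℕ
    Δ²≤484Qn : Δ * Δ ≤ 484 * Q * n
    tail : ∀ p q → p + q ≡ n → q + Δ < p → 2 ^ (Q + 9) * mid M ^ n ≤ up M ^ p * down M ^ q

exponentialTail : ∀ n Q → 1 ≤ Q → Q ≤ n → ExponentialTail n Q
exponentialTail n Q 1≤Q Q≤n with ∃M[Q[1+M]²≤n≤Q·mid²] n Q 1≤Q Q≤n
... | M , Q[1+M]²≤n , n≤Q·mid² = record
  { M = M ; Δ = Δ ; Δ²≤484Qn = Δ²≤484Qn ; tail = drift⇒2^[Q+9]*mid^n≤up^p*down^q M Q n n≤Q·mid² }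
  where
  open ≤-Reasoning
  Δ = (2 * Q + 9) * mid M
  2Q+9≤11Q : 2 * Q + 9 ≤ 11 * Q
  2Q+9≤11Q = ≤-trans (+-monoʳ-≤ (2 * Q) (*-monoʳ-≤ 9 1≤Q)) (≤-reflexive (sum Q))
    where
    sum : ∀ Q → 2 * Q + 9 * Q ≡ 11 * Q
    sum = solve-∀
  Δ²≤484Qn : Δ * Δ ≤ 484 * Q * n
  Δ²≤484Qn = begin
    Δ * Δ                                 ≤⟨ *-mono-≤ (*-monoˡ-≤ (mid M) 2Q+9≤11Q) (*-monoˡ-≤ (mid M) 2Q+9≤11Q) ⟩
    11 * Q * mid M * (11 * Q * mid M)     ≡⟨ square Q M ⟩
    484 * Q * (Q * (suc M * suc M))       ≤⟨ *-monoʳ-≤ (484 * Q) Q[1+M]²≤n ⟩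
    484 * Q * n                           ∎
    where
    square : ∀ Q M → 11 * Q * (2 + 2 * M) * (11 * Q * (2 + 2 * M)) ≡ 484 * Q * (Q * (suc M * suc M))
    square = solve-∀

∑ : {A : Set} → List A → (A → ℕ) → ℕ
∑ []       f = 0
∑ (x ∷ xs) f = f x + ∑ xs f

∏ : {A : Set} → List A → (A → ℕ) → ℕ
∏ xs f = foldr (λ x acc → f x * acc) 1 xs

infix 5 ∑ ∏
syntax ∑ xs (λ x → e) = ∑[ x ← xs ] e
syntax ∏ xs (λ x → e) = ∏[ x ← xs ] e

module _ {A : Set} where

  ∑-++ : ∀ xs ys (f : A → ℕ) → ∑ (xs ++ ys) f ≡ ∑ xs f + ∑ ys f
  ∑-++ []       ys f = refl
  ∑-++ (x ∷ xs) ys f = trans (cong (f x +_) (∑-++ xs ys f)) (sym (+-assoc (f x) _ _))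

  ∑-cong : ∀ {f g : A → ℕ} → (∀ x → f x ≡ g x) → ∀ xs → ∑ xs f ≡ ∑ xs g
  ∑-cong f≡g []       = refl
  ∑-cong f≡g (x ∷ xs) = cong₂ _+_ (f≡g x) (∑-cong f≡g xs)

  ∑-*ˡ : ∀ c (f : A → ℕ) xs → ∑[ x ← xs ] c * f x ≡ c * ∑ xs f
  ∑-*ˡ c f []       = sym (*-zeroʳ c)
  ∑-*ˡ c f (x ∷ xs) = trans (cong (c * f x +_) (∑-*ˡ c f xs)) (sym (*-distribˡ-+ c (f x) _))

  ∑-*ʳ : ∀ c (f : A → ℕ) xs → ∑[ x ← xs ] f x * c ≡ ∑ xs f * c
  ∑-*ʳ c f xs = trans (∑-cong (λ x → *-comm (f x) c) xs) (trans (∑-*ˡ c f xs) (*-comm c _))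

  ∑-+ : ∀ (f g : A → ℕ) xs → ∑[ x ← xs ] (f x + g x) ≡ ∑ xs f + ∑ xs g
  ∑-+ f g []       = refl
  ∑-+ f g (x ∷ xs) = trans (cong (f x + g x +_) (∑-+ f g xs)) (interchange (f x) (g x) _ _)
    where
    interchange : ∀ a b c d → a + b + (c + d) ≡ a + c + (b + d)
    interchange = solve-∀

  ∑-const : ∀ c (xs : List A) → ∑[ _ ← xs ] c ≡ length xs * c
  ∑-const c []       = refl
  ∑-const c (x ∷ xs) = cong (c +_) (∑-const c xs)

  ∑-∈ : ∀ (f : A → ℕ) {x xs} → x ∈ xs → f x ≤ ∑ xs f
  ∑-∈ f (here refl)            = m≤m+n _ _
  ∑-∈ f {xs = y ∷ _} (there p) = ≤-trans (∑-∈ f p) (m≤n+m _ (f y))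

  markov : ∀ {p} {P : Pred A p} (P? : Decidable P) (w : A → ℕ) t →
           (∀ x → P x → t ≤ w x) → ∀ xs → t * length (filter P? xs) ≤ ∑ xs w
  markov P? w t P⇒t≤w []       = ≤-reflexive (*-zeroʳ t)
  markov P? w t P⇒t≤w (x ∷ xs) with P? x
  ... | yes px = ≤-trans (≤-reflexive (*-suc t _)) (+-mono-≤ (P⇒t≤w x px) (markov P? w t P⇒t≤w xs))
  ... | no  _  = ≤-trans (markov P? w t P⇒t≤w xs) (m≤n+m _ (w x))

  length-filter+length-filter-¬ : ∀ {p} {P : Pred A p} (P? : Decidable P) xs →
    length (filter P? xs) + length (filter (¬? ∘ P?) xs) ≡ length xs
  length-filter+length-filter-¬ P? []       = refl
  length-filter+length-filter-¬ P? (x ∷ xs) with P? x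
  ... | yes _ = cong suc (length-filter+length-filter-¬ P? xs)
  ... | no  _ = trans (+-suc _ _) (cong suc (length-filter+length-filter-¬ P? xs))

  length-filter-¬×≤ : ∀ {p q} {P : Pred A p} {Q : Pred A q} (P? : Decidable P) (Q? : Decidable Q) xs →
    length (filter (λ x → ¬? (P? x ×-dec Q? x)) xs) ≤ length (filter (¬? ∘ P?) xs) + length (filter (¬? ∘ Q?) xs)
  length-filter-¬×≤ P? Q? []       = z≤n
  length-filter-¬×≤ P? Q? (x ∷ xs) with P? x | Q? x
  ... | yes _ | yes _ = length-filter-¬×≤ P? Q? xs
  ... | yes _ | no  _ = ≤-trans (s≤s (length-filter-¬×≤ P? Q? xs)) (≤-reflexive (sym (+-suc _ _)))
  ... | no  _ | yes _ = s≤s (length-filter-¬×≤ P? Q? xs)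
  ... | no  _ | no  _ = s≤s (≤-trans (length-filter-¬×≤ P? Q? xs) (+-monoʳ-≤ _ (n≤1+n _)))

∑-swap : ∀ {A B : Set} xs ys (f : A → B → ℕ) → ∑[ x ← xs ] ∑[ y ← ys ] f x y ≡ ∑[ y ← ys ] ∑[ x ← xs ] f x y
∑-swap []       ys f = sym (trans (∑-const 0 ys) (*-zeroʳ (length ys)))
∑-swap (x ∷ xs) ys f = trans (cong (∑ ys (f x) +_) (∑-swap xs ys f)) (sym (∑-+ (f x) _ ys))

∑-map : ∀ {A B : Set} (g : A → B) xs (f : B → ℕ) → ∑ (map g xs) f ≡ ∑[ x ← xs ] f (g x)
∑-map g []       f = refl
∑-map g (x ∷ xs) f = cong (f (g x) +_) (∑-map g xs f)

∑-cartesianProductWith : ∀ {A B C : Set} (g : A → B → C) xs ys (f : C → ℕ) →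
  ∑ (cartesianProductWith g xs ys) f ≡ ∑[ x ← xs ] ∑[ y ← ys ] f (g x y)
∑-cartesianProductWith g []       ys f = refl
∑-cartesianProductWith g (x ∷ xs) ys f = trans (∑-++ (map (g x) ys) _ f)
  (cong₂ _+_ (∑-map (g x) ys f) (∑-cartesianProductWith g xs ys f))

length-cartesianProductWith : ∀ {A B C : Set} (g : A → B → C) xs ys →
  length (cartesianProductWith g xs ys) ≡ length xs * length ys
length-cartesianProductWith g []       ys = refl
length-cartesianProductWith g (x ∷ xs) ys = trans (length-++ (map (g x) ys))
  (cong₂ _+_ (length-map (g x) ys) (length-cartesianProductWith g xs ys))

∑≤length*c : ∀ {A : Set} {f : A → ℕ} {c} {xs} → All (λ x → f x ≤ c) xs → ∑ xs f ≤ length xs * c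
∑≤length*c []           = z≤n
∑≤length*c (fx≤c ∷ f≤c) = +-mono-≤ fx≤c (∑≤length*c f≤c)

module _ {A : Set} where

  ∏-cong : ∀ {f g : A → ℕ} → (∀ x → f x ≡ g x) → ∀ xs → ∏ xs f ≡ ∏ xs g
  ∏-cong f≡g []       = refl
  ∏-cong f≡g (x ∷ xs) = cong₂ _*_ (f≡g x) (∏-cong f≡g xs)

  ∏-const : ∀ c (xs : List A) → ∏[ _ ← xs ] c ≡ c ^ length xs
  ∏-const c []       = refl
  ∏-const c (x ∷ xs) = cong (c *_) (∏-const c xs)

foldr-allFin-suc : ∀ {B : Set} n (g : Fin (suc n) → B → B) z →
  foldr g z (allFin (suc n)) ≡ g zero (foldr (g ∘ suc) z (allFin n))
foldr-allFin-suc n g z = cong (g zero)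
  (trans (cong (foldr g z) (sym (map-tabulate (λ i → i) suc))) (foldr-map g suc z (allFin n)))

length-allFin : ∀ n → length (allFin n) ≡ n
length-allFin n = length-tabulate (λ i → i)

allVecs : ∀ {A : Set} → List A → (n : ℕ) → List (Vec A n)
allVecs xs zero    = [] ∷ []
allVecs xs (suc n) = cartesianProductWith _∷_ xs (allVecs xs n)

length-allVecs : ∀ {A : Set} (xs : List A) n → length (allVecs xs n) ≡ length xs ^ n
length-allVecs xs zero    = refl
length-allVecs xs (suc n) = trans (length-cartesianProductWith _∷_ xs (allVecs xs n))
  (cong (length xs *_) (length-allVecs xs n))

allVecs-unique : ∀ {A : Set} {xs : List A} n → Unique xs → Unique (allVecs xs n)
allVecs-unique zero    _      = [] AllPairs.∷ AllPairs.[]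
allVecs-unique (suc n) xs-uniq = Unique.cartesianProductWith⁺ _∷_ Vec.∷-injective xs-uniq (allVecs-unique n xs-uniq)

∑-allVecs-suc : ∀ {A : Set} (xs : List A) n (f : Vec A (suc n) → ℕ) →
  ∑ (allVecs xs (suc n)) f ≡ ∑[ x ← xs ] ∑[ v ← allVecs xs n ] f (x ∷ v)
∑-allVecs-suc xs n f = ∑-cartesianProductWith _∷_ xs (allVecs xs n) f

bools : List Bool
bools = false ∷ true ∷ []

allBoolVecs : (m : ℕ) → List (Vec Bool m)
allBoolVecs = allVecs bools

allGraphs : (k m : ℕ) → List (BipGraph k m)
allGraphs k m = allVecs (allBoolVecs m) k

allGraphs-unique : ∀ k m → Unique (allGraphs k m)
allGraphs-unique k m = allVecs-unique k (allVecs-unique m bools-unique)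
  where
  bools-unique : Unique bools
  bools-unique = ((λ ()) ∷ []) AllPairs.∷ ([] AllPairs.∷ AllPairs.[])

length-allBoolVecs : ∀ m → length (allBoolVecs m) ≡ 2 ^ m
length-allBoolVecs = length-allVecs bools

length-allGraphs : ∀ k m → length (allGraphs k m) ≡ 2 ^ (k * m)
length-allGraphs k m = begin
  length (allGraphs k m) ≡⟨ length-allVecs (allBoolVecs m) k ⟩
  length (allBoolVecs m) ^ k ≡⟨ cong (_^ k) (length-allBoolVecs m) ⟩
  (2 ^ m) ^ k            ≡⟨ ^-*-assoc 2 m k ⟩
  2 ^ (m * k)            ≡⟨ cong (2 ^_) (*-comm m k) ⟩
  2 ^ (k * m)            ∎
  where open ≡-Reasoning

∑-allBoolVecs-∏ : ∀ m (F : Fin m → Bool → ℕ) →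
  ∑[ v ← allBoolVecs m ] ∏[ j ← allFin m ] F j (lookup v j) ≡ ∏[ j ← allFin m ] (F j false + F j true)
∑-allBoolVecs-∏ zero    F = refl
∑-allBoolVecs-∏ (suc m) F = begin
  ∑[ v ← allBoolVecs (suc m) ] ∏[ j ← allFin (suc m) ] F j (lookup v j)
    ≡⟨ ∑-allVecs-suc bools m _ ⟩
  ∑[ x ← bools ] ∑[ v ← allBoolVecs m ] ∏[ j ← allFin (suc m) ] F j (lookup (x ∷ v) j)
    ≡⟨ ∑-cong (λ x → trans (∑-cong (∏-allFin-suc x) (allBoolVecs m))
         (trans (∑-*ˡ (F zero x) _ (allBoolVecs m)) (cong (F zero x *_) (∑-allBoolVecs-∏ m (F ∘ suc))))) bools ⟩
  F zero false * R + (F zero true * R + 0)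
    ≡⟨ factor (F zero false) (F zero true) R ⟩
  (F zero false + F zero true) * R
    ≡⟨ sym (foldr-allFin-suc m (λ j acc → (F j false + F j true) * acc) 1) ⟩
  ∏[ j ← allFin (suc m) ] (F j false + F j true) ∎
  where
  open ≡-Reasoning
  R = ∏[ j ← allFin m ] (F (suc j) false + F (suc j) true)
  ∏-allFin-suc : ∀ x v → ∏[ j ← allFin (suc m) ] F j (lookup (x ∷ v) j) ≡ F zero x * (∏[ j ← allFin m ] F (suc j) (lookup v j))
  ∏-allFin-suc x v = foldr-allFin-suc m (λ j acc → F j (lookup (x ∷ v) j) * acc) 1
  factor : ∀ a b r → a * r + (b * r + 0) ≡ (a + b) * r
  factor = solve-∀

-- Exponential moments of column sums and of u_S

weight : ℕ → ℕ → Bool → ℕ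
weight a b true  = a
weight a b false = b

-- A fold rather than length ∘ filter, so that degV G j is definitionally countTrue (λ i → edge G i j) (allFin k).
countTrue : ∀ {A : Set} → (A → Bool) → List A → ℕ
countTrue f = foldr (λ x acc → if f x then suc acc else acc) 0

countFalse : ∀ {A : Set} → (A → Bool) → List A → ℕ
countFalse f = countTrue (not ∘ f)

countTrue+countFalse≡length : ∀ {A : Set} (f : A → Bool) xs → countTrue f xs + countFalse f xs ≡ length xs
countTrue+countFalse≡length f []       = refl
countTrue+countFalse≡length f (x ∷ xs) with f x
... | true  = cong suc (countTrue+countFalse≡length f xs)
... | false = trans (+-suc _ _) (cong suc (countTrue+countFalse≡length f xs))

∏-weight : ∀ {A : Set} a b (f : A → Bool) xs → ∏[ x ← xs ] weight a b (f x) ≡ a ^ countTrue f xs * b ^ countFalse f xs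
∏-weight a b f []       = refl
∏-weight a b f (x ∷ xs) with f x
... | true  = trans (cong (a *_) (∏-weight a b f xs)) (sym (*-assoc a _ _))
... | false = trans (cong (b *_) (∏-weight a b f xs)) (x∙yz≈y∙xz b (a ^ countTrue f xs) _)
  where
  x∙yz≈y∙xz : ∀ b p q → b * (p * q) ≡ p * (b * q)
  x∙yz≈y∙xz = solve-∀

∑-allBoolVecs-weight : ∀ a b L m (j : Fin m) → a + b ≡ 2 * L → ∑[ v ← allBoolVecs m ] weight a b (lookup v j) ≡ 2 ^ m * L
∑-allBoolVecs-weight a b L (suc m) zero    a+b≡2L = begin
  ∑[ v ← allBoolVecs (suc m) ] weight a b (lookup v zero)  ≡⟨ ∑-allVecs-suc bools m _ ⟩
  ∑[ x ← bools ] ∑[ v ← allBoolVecs m ] weight a b x      ≡⟨ ∑-cong (λ x → ∑-const (weight a b x) (allBoolVecs m)) bools ⟩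
  length (allBoolVecs m) * b + (length (allBoolVecs m) * a + 0) ≡⟨ cong (λ n → n * b + (n * a + 0)) (length-allBoolVecs m) ⟩
  2 ^ m * b + (2 ^ m * a + 0)                           ≡⟨ factor (2 ^ m) a b ⟩
  2 ^ m * (a + b)                                       ≡⟨ cong (2 ^ m *_) a+b≡2L ⟩
  2 ^ m * (2 * L)                                       ≡⟨ regroup (2 ^ m) L ⟩
  2 * 2 ^ m * L                                         ∎
  where
  open ≡-Reasoning
  factor : ∀ n a b → n * b + (n * a + 0) ≡ n * (a + b)
  factor = solve-∀
  regroup : ∀ n L → n * (2 * L) ≡ 2 * n * L
  regroup = solve-∀
∑-allBoolVecs-weight a b L (suc m) (suc j) a+b≡2L = begin
  ∑[ v ← allBoolVecs (suc m) ] weight a b (lookup v (suc j)) ≡⟨ ∑-allVecs-suc bools m _ ⟩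
  ∑[ x ← bools ] ∑[ v ← allBoolVecs m ] weight a b (lookup v j) ≡⟨ cong (λ s → s + (s + 0)) (∑-allBoolVecs-weight a b L m j a+b≡2L) ⟩
  2 ^ m * L + (2 ^ m * L + 0)                                  ≡⟨ double (2 ^ m) L ⟩
  2 * 2 ^ m * L                                                ∎
  where
  open ≡-Reasoning
  double : ∀ n L → n * L + (n * L + 0) ≡ 2 * n * L
  double = solve-∀

∑-allGraphs-columnWeight : ∀ a b L k m (j : Fin m) → a + b ≡ 2 * L →
  ∑[ G ← allGraphs k m ] ∏[ i ← allFin k ] weight a b (edge G i j) ≡ 2 ^ (k * m) * L ^ k
∑-allGraphs-columnWeight a b L zero    m j a+b≡2L = refl
∑-allGraphs-columnWeight a b L (suc k) m j a+b≡2L = begin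
  ∑[ G ← allGraphs (suc k) m ] ∏[ i ← allFin (suc k) ] weight a b (edge G i j)
    ≡⟨ ∑-allVecs-suc (allBoolVecs m) k _ ⟩
  ∑[ row ← allBoolVecs m ] ∑[ G ← allGraphs k m ] ∏[ i ← allFin (suc k) ] weight a b (edge (row ∷ G) i j)
    ≡⟨ ∑-cong (λ row → trans (∑-cong (∏-allFin-suc row) (allGraphs k m))
         (trans (∑-*ˡ (weight a b (lookup row j)) _ (allGraphs k m))
           (cong (weight a b (lookup row j) *_) (∑-allGraphs-columnWeight a b L k m j a+b≡2L)))) (allBoolVecs m) ⟩
  ∑[ row ← allBoolVecs m ] weight a b (lookup row j) * (2 ^ (k * m) * L ^ k)
    ≡⟨ ∑-*ʳ _ (λ row → weight a b (lookup row j)) (allBoolVecs m) ⟩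
  (∑[ row ← allBoolVecs m ] weight a b (lookup row j)) * (2 ^ (k * m) * L ^ k)
    ≡⟨ cong (_* (2 ^ (k * m) * L ^ k)) (∑-allBoolVecs-weight a b L m j a+b≡2L) ⟩
  2 ^ m * L * (2 ^ (k * m) * L ^ k)
    ≡⟨ interchange (2 ^ m) L (2 ^ (k * m)) (L ^ k) ⟩
  2 ^ m * 2 ^ (k * m) * (L * L ^ k)
    ≡⟨ cong (_* (L * L ^ k)) (sym (^-distribˡ-+-* 2 m (k * m))) ⟩
  2 ^ (suc k * m) * L ^ suc k ∎
  where
  open ≡-Reasoning
  ∏-allFin-suc : ∀ row G → ∏[ i ← allFin (suc k) ] weight a b (edge (row ∷ G) i j)
                         ≡ weight a b (lookup row j) * (∏[ i ← allFin k ] weight a b (edge G i j))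
  ∏-allFin-suc row G = foldr-allFin-suc k (λ i acc → weight a b (edge (row ∷ G) i j) * acc) 1
  interchange : ∀ a b c d → a * b * (c * d) ≡ a * c * (b * d)
  interchange = solve-∀

-- u_S(j) = 1 iff j has an even number of non-neighbours in S.
uBit : ∀ {k m} → BipGraph k m → Subset k → Fin m → Bool
uBit {k} G S j = foldr (λ i b → if lookup S i ∧ not (edge G i j) then not b else b) true (allFin k)

uBit-∷ : ∀ {k m} (row : Vec Bool m) (G : BipGraph k m) s S j →
  uBit (row ∷ G) (s ∷ S) j ≡ (if s ∧ not (lookup row j) then not (uBit G S j) else uBit G S j)
uBit-∷ {k} row G s S j = foldr-allFin-suc k (λ i b → if lookup (s ∷ S) i ∧ not (edge (row ∷ G) i j) then not b else b) true

-- If vertex 0 lies in S, summing over its row first turns every factor into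
-- weight(not c) + weight(c) = 2L, whatever the other rows are; otherwise that row does not affect u_S.
∑-allGraphs-uWeight : ∀ a b L k m (S : Subset k) → 1 ≤ ∣ S ∣ → a + b ≡ 2 * L →
  ∑[ G ← allGraphs k m ] ∏[ j ← allFin m ] weight a b (uBit G S j) ≡ 2 ^ (k * m) * L ^ m
∑-allGraphs-uWeight a b L (suc k) m (false ∷ S) S≢∅ a+b≡2L = begin
  ∑[ G ← allGraphs (suc k) m ] ∏[ j ← allFin m ] weight a b (uBit G (false ∷ S) j)
    ≡⟨ ∑-allVecs-suc (allBoolVecs m) k _ ⟩
  ∑[ row ← allBoolVecs m ] ∑[ G ← allGraphs k m ] ∏[ j ← allFin m ] weight a b (uBit (row ∷ G) (false ∷ S) j)
    ≡⟨ ∑-cong (λ row → trans (∑-cong (λ G → ∏-cong (λ j → cong (weight a b) (uBit-∷ row G false S j)) (allFin m)) (allGraphs k m))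
                             (∑-allGraphs-uWeight a b L k m S S≢∅ a+b≡2L)) (allBoolVecs m) ⟩
  ∑[ row ← allBoolVecs m ] 2 ^ (k * m) * L ^ m
    ≡⟨ ∑-const _ (allBoolVecs m) ⟩
  length (allBoolVecs m) * (2 ^ (k * m) * L ^ m)
    ≡⟨ cong (_* (2 ^ (k * m) * L ^ m)) (length-allBoolVecs m) ⟩
  2 ^ m * (2 ^ (k * m) * L ^ m)
    ≡⟨ sym (*-assoc (2 ^ m) (2 ^ (k * m)) (L ^ m)) ⟩
  2 ^ m * 2 ^ (k * m) * L ^ m
    ≡⟨ cong (_* L ^ m) (sym (^-distribˡ-+-* 2 m (k * m))) ⟩
  2 ^ (suc k * m) * L ^ m ∎
  where open ≡-Reasoning
∑-allGraphs-uWeight a b L (suc k) m (true ∷ S) _ a+b≡2L = begin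
  ∑[ G ← allGraphs (suc k) m ] ∏[ j ← allFin m ] weight a b (uBit G (true ∷ S) j)
    ≡⟨ ∑-allVecs-suc (allBoolVecs m) k _ ⟩
  ∑[ row ← allBoolVecs m ] ∑[ G ← allGraphs k m ] ∏[ j ← allFin m ] weight a b (uBit (row ∷ G) (true ∷ S) j)
    ≡⟨ ∑-swap (allBoolVecs m) (allGraphs k m) _ ⟩
  ∑[ G ← allGraphs k m ] ∑[ row ← allBoolVecs m ] ∏[ j ← allFin m ] weight a b (uBit (row ∷ G) (true ∷ S) j)
    ≡⟨ ∑-cong sum-over-row (allGraphs k m) ⟩
  ∑[ G ← allGraphs k m ] (2 * L) ^ m
    ≡⟨ ∑-const _ (allGraphs k m) ⟩
  length (allGraphs k m) * (2 * L) ^ m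
    ≡⟨ cong₂ _*_ (length-allGraphs k m) (^-distribʳ-* 2 L m) ⟩
  2 ^ (k * m) * (2 ^ m * L ^ m)
    ≡⟨ rearrange (2 ^ (k * m)) (2 ^ m) (L ^ m) ⟩
  2 ^ m * 2 ^ (k * m) * L ^ m
    ≡⟨ cong (_* L ^ m) (sym (^-distribˡ-+-* 2 m (k * m))) ⟩
  2 ^ (suc k * m) * L ^ m ∎
  where
  open ≡-Reasoning
  rearrange : ∀ x y z → x * (y * z) ≡ y * x * z
  rearrange = solve-∀
  weight-not+weight : ∀ c → weight a b (not c) + weight a b c ≡ 2 * L
  weight-not+weight false = a+b≡2L
  weight-not+weight true  = trans (+-comm b a) a+b≡2L
  sum-over-row : ∀ G → ∑[ row ← allBoolVecs m ] ∏[ j ← allFin m ] weight a b (uBit (row ∷ G) (true ∷ S) j) ≡ (2 * L) ^ m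
  sum-over-row G = begin
    ∑[ row ← allBoolVecs m ] ∏[ j ← allFin m ] weight a b (uBit (row ∷ G) (true ∷ S) j)
      ≡⟨ ∑-cong (λ row → ∏-cong (λ j → cong (weight a b) (uBit-∷ row G true S j)) (allFin m)) (allBoolVecs m) ⟩
    ∑[ row ← allBoolVecs m ] ∏[ j ← allFin m ] weight a b (if not (lookup row j) then not (uBit G S j) else uBit G S j)
      ≡⟨ ∑-allBoolVecs-∏ m (λ j e → weight a b (if not e then not (uBit G S j) else uBit G S j)) ⟩
    ∏[ j ← allFin m ] (weight a b (not (uBit G S j)) + weight a b (uBit G S j))
      ≡⟨ ∏-cong (weight-not+weight ∘ uBit G S) (allFin m) ⟩
    ∏[ j ← allFin m ] 2 * L
      ≡⟨ ∏-const (2 * L) (allFin m) ⟩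
    (2 * L) ^ length (allFin m)
      ≡⟨ cong ((2 * L) ^_) (length-allFin m) ⟩
    (2 * L) ^ m ∎

sign : Bool → ℤ
sign true  = ℤ.+ 1
sign false = -[1+ 0 ]

u≡sign∘uBit : ∀ {k m} (G : BipGraph k m) S j → u G S j ≡ sign (uBit G S j)
u≡sign∘uBit {k} G S j = go (allFin k)
  where
  step : ∀ s e c → (if s then (if e then ℤ.+ 1 else -[1+ 0 ]) else ℤ.+ 1) ℤ.* sign c ≡ sign (if s ∧ not e then not c else c)
  step true  true  true  = refl
  step true  true  false = refl
  step true  false true  = refl
  step true  false false = refl
  step false _     true  = refl
  step false _     false = refl
  go : ∀ is → foldr (λ i acc → (if lookup S i then H G i j else ℤ.+ 1) ℤ.* acc) (ℤ.+ 1) is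
            ≡ sign (foldr (λ i c → if lookup S i ∧ not (edge G i j) then not c else c) true is)
  go []       = refl
  go (i ∷ is) = trans (cong ((if lookup S i then H G i j else ℤ.+ 1) ℤ.*_) (go is)) (step (lookup S i) (edge G i j) _)

∑sign≡countTrue-countFalse : ∀ {A : Set} (f : A → Bool) (g : A → ℤ) → (∀ x → g x ≡ sign (f x)) → ∀ xs →
  foldr (λ x acc → g x ℤ.+ acc) (ℤ.+ 0) xs ≡ ℤ.+ countTrue f xs ℤ.- ℤ.+ countFalse f xs
∑sign≡countTrue-countFalse f g g≡sign∘f []       = refl
∑sign≡countTrue-countFalse f g g≡sign∘f (x ∷ xs)
  rewrite g≡sign∘f x | ∑sign≡countTrue-countFalse f g g≡sign∘f xs with f x
... | true  = plus (ℤ.+ countTrue f xs) (ℤ.+ countFalse f xs)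
  where
  plus : ∀ p q → ℤ.+ 1 ℤ.+ (p ℤ.- q) ≡ (ℤ.+ 1 ℤ.+ p) ℤ.- q
  plus = ℤ-Solver.solve-∀
... | false = minus (ℤ.+ countTrue f xs) (ℤ.+ countFalse f xs)
  where
  minus : ∀ p q → -[1+ 0 ] ℤ.+ (p ℤ.- q) ≡ p ℤ.- (ℤ.+ 1 ℤ.+ q)
  minus = ℤ-Solver.solve-∀

sumU≡countTrue-countFalse : ∀ {k m} (G : BipGraph k m) S →
  sumU G S ≡ ℤ.+ countTrue (uBit G S) (allFin m) ℤ.- ℤ.+ countFalse (uBit G S) (allFin m)
sumU≡countTrue-countFalse {m = m} G S = ∑sign≡countTrue-countFalse (uBit G S) (u G S) (u≡sign∘uBit G S) (allFin m)

∣+p-+q∣≤Δ : ∀ p q Δ → p ≤ q + Δ → q ≤ p + Δ → ℤ.∣ ℤ.+ p ℤ.- ℤ.+ q ∣ ≤ Δ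
∣+p-+q∣≤Δ p q Δ p≤q+Δ q≤p+Δ rewrite ℤ.[+m]-[+n]≡m⊖n p q with p ≤? q
... | yes p≤q rewrite ℤ.∣⊖∣-≤ p≤q = m≤n+o⇒m∸n≤o q p q≤p+Δ
... | no  p≰q rewrite ℤ.∣m⊖n∣≡∣n⊖m∣ p q | ℤ.∣⊖∣-≤ (<⇒≤ (≰⇒> p≰q)) = m≤n+o⇒m∸n≤o p q p≤q+Δ

∣+p-+q∣>Δ⇒ : ∀ p q Δ → ¬ ℤ.∣ ℤ.+ p ℤ.- ℤ.+ q ∣ ≤ Δ → q + Δ < p ⊎ p + Δ < q
∣+p-+q∣>Δ⇒ p q Δ ∣p-q∣≰Δ with p ≤? q + Δ | q ≤? p + Δ
... | yes p≤q+Δ | yes q≤p+Δ = contradiction (∣+p-+q∣≤Δ p q Δ p≤q+Δ q≤p+Δ) ∣p-q∣≰Δ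
... | no  p≰q+Δ | _         = inj₁ (≰⇒> p≰q+Δ)
... | yes _     | no q≰p+Δ  = inj₂ (≰⇒> q≰p+Δ)

∣sumU∣≤m : ∀ {k m} (G : BipGraph k m) S → ℤ.∣ sumU G S ∣ ≤ m
∣sumU∣≤m {m = m} G S rewrite sumU≡countTrue-countFalse G S = ∣+p-+q∣≤Δ p q m
  (≤-trans (m≤m+n p q) (≤-trans (≤-reflexive p+q≡m) (m≤n+m m q)))
  (≤-trans (m≤n+m q p) (≤-trans (≤-reflexive p+q≡m) (m≤n+m m p)))
  where
  p = countTrue (uBit G S) (allFin m)
  q = countFalse (uBit G S) (allFin m)
  p+q≡m : p + q ≡ m
  p+q≡m = trans (countTrue+countFalse≡length (uBit G S) (allFin m)) (length-allFin m)

subsetsOfSize≤ : (k r : ℕ) → List (Subset k)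
subsetsOfSize≤ zero    r       = [] ∷ []
subsetsOfSize≤ (suc k) zero    = map (false ∷_) (subsetsOfSize≤ k zero)
subsetsOfSize≤ (suc k) (suc r) = map (false ∷_) (subsetsOfSize≤ k (suc r)) ++ map (true ∷_) (subsetsOfSize≤ k r)

∈-subsetsOfSize≤ : ∀ k r (S : Subset k) → ∣ S ∣ ≤ r → S ∈ subsetsOfSize≤ k r
∈-subsetsOfSize≤ zero    r       []          _         = here refl
∈-subsetsOfSize≤ (suc k) zero    (false ∷ S) ∣S∣≤0     = ∈-map⁺ (false ∷_) (∈-subsetsOfSize≤ k zero S ∣S∣≤0)
∈-subsetsOfSize≤ (suc k) (suc r) (false ∷ S) ∣S∣≤1+r   = ∈-++⁺ˡ (∈-map⁺ (false ∷_) (∈-subsetsOfSize≤ k (suc r) S ∣S∣≤1+r))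
∈-subsetsOfSize≤ (suc k) (suc r) (true ∷ S)  (s≤s ∣S∣≤r) =
  ∈-++⁺ʳ (map (false ∷_) (subsetsOfSize≤ k (suc r))) (∈-map⁺ (true ∷_) (∈-subsetsOfSize≤ k r S ∣S∣≤r))

length-subsetsOfSize≤ : ∀ k r → length (subsetsOfSize≤ k r) ≤ suc k ^ r
length-subsetsOfSize≤ zero    r       = ≤-reflexive (sym (^-zeroˡ r))
length-subsetsOfSize≤ (suc k) zero    = ≤-trans (≤-reflexive (length-map (false ∷_) (subsetsOfSize≤ k zero)))
                                                (length-subsetsOfSize≤ k zero)
length-subsetsOfSize≤ (suc k) (suc r) = begin
  length (map (false ∷_) (subsetsOfSize≤ k (suc r)) ++ map (true ∷_) (subsetsOfSize≤ k r))
    ≡⟨ length-++ (map (false ∷_) (subsetsOfSize≤ k (suc r))) ⟩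
  length (map (false ∷_) (subsetsOfSize≤ k (suc r))) + length (map (true ∷_) (subsetsOfSize≤ k r))
    ≡⟨ cong₂ _+_ (length-map (false ∷_) (subsetsOfSize≤ k (suc r))) (length-map (true ∷_) (subsetsOfSize≤ k r)) ⟩
  length (subsetsOfSize≤ k (suc r)) + length (subsetsOfSize≤ k r)
    ≤⟨ +-mono-≤ (length-subsetsOfSize≤ k (suc r)) (length-subsetsOfSize≤ k r) ⟩
  suc k * suc k ^ r + suc k ^ r
    ≡⟨ +-comm (suc k * suc k ^ r) _ ⟩
  suc (suc k) * suc k ^ r
    ≤⟨ *-monoʳ-≤ (suc (suc k)) (^-monoˡ-≤ r (n≤1+n (suc k))) ⟩
  suc (suc k) ^ suc r ∎
  where open ≤-Reasoning

nonemptySubsetsOfSize≤ : (k r : ℕ) → List (Subset k)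
nonemptySubsetsOfSize≤ k r = filter (λ S → 1 ≤? ∣ S ∣) (subsetsOfSize≤ k r)

-- Typical graphs

-- P fails on at most 1/200 of all graphs; the decidable strengthening Good makes the failures countable.
record Typically (k m : ℕ) (P : BipGraph k m → Set) : Set₁ where
  field
    Good          : BipGraph k m → Set
    good?         : Decidable Good
    Good⇒P        : ∀ {G} → Good G → P G
    rarelyFailing : 200 * length (filter (¬? ∘ good?) (allGraphs k m)) ≤ 2 ^ (k * m)

typically-always : ∀ {k m} {P : BipGraph k m → Set} → (∀ G → P G) → Typically k m P
typically-always {k} {m} always = record
  { Good = λ _ → ⊤ ; good? = λ _ → yes tt ; Good⇒P = λ {G} _ → always G
  ; rarelyFailing = subst (λ xs → 200 * length xs ≤ 2 ^ (k * m)) (sym no-failures) z≤n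
  }
  where
  no-failures : filter (λ _ → ¬? (yes tt)) (allGraphs k m) ≡ []
  no-failures = filter-none (λ _ → ¬? (yes tt)) (All.universal (λ _ ¬⊤ → ¬⊤ tt) (allGraphs k m))

typically-mono : ∀ {k m} {P R : BipGraph k m → Set} → (∀ G → P G → R G) → Typically k m P → Typically k m R
typically-mono P⇒R typ = record { Typically typ ; Good⇒P = λ {G} good → P⇒R G (Typically.Good⇒P typ good) }

-- Markov's inequality for the total weight W = ∑ₜ w(·, t), together with the union bound over the tests.
typically-byMoments : ∀ {k m} {T : Set} (tests : List T) {Ok : BipGraph k m → T → Set}
  (ok? : ∀ G → Decidable (Ok G)) (w : BipGraph k m → T → ℕ) (Q n L : ℕ) .{{_ : NonZero L}} →
  length tests ≤ 2 ^ Q →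
  All (λ t → ∑[ G ← allGraphs k m ] w G t ≤ 2 * (2 ^ (k * m) * L ^ n)) tests →
  (∀ G t → ¬ Ok G t → 2 ^ (Q + 9) * L ^ n ≤ w G t) →
  Typically k m (λ G → All (Ok G) tests)
typically-byMoments {k} {m} tests {Ok} ok? w Q n L #tests≤2^Q moment-bound ¬Ok⇒θ≤w = record
  { Good = λ G → All (Ok G) tests ; good? = good? ; Good⇒P = λ good → good ; rarelyFailing = rarelyFailing }
  where
  open ≤-Reasoning
  N = 2 ^ (k * m)
  θ = 2 ^ (Q + 9) * L ^ n
  good? : Decidable (λ G → All (Ok G) tests)
  good? G = all? (ok? G) tests
  W : BipGraph k m → ℕ
  W G = ∑[ t ← tests ] w G t
  #bad = length (filter (¬? ∘ good?) (allGraphs k m))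
  bad⇒θ≤W : ∀ G → ¬ All (Ok G) tests → θ ≤ W G
  bad⇒θ≤W G bad with find (¬All⇒Any¬ (ok? G) tests bad)
  ... | t , t∈tests , ¬ok = ≤-trans (¬Ok⇒θ≤w G t ¬ok) (∑-∈ (λ t → w G t) t∈tests)
  θ*#bad≤ : θ * #bad ≤ 2 ^ Q * (2 * (N * L ^ n))
  θ*#bad≤ = begin
    θ * #bad                                           ≤⟨ markov (¬? ∘ good?) W θ bad⇒θ≤W (allGraphs k m) ⟩
    ∑[ G ← allGraphs k m ] ∑[ t ← tests ] w G t        ≡⟨ ∑-swap (allGraphs k m) tests w ⟩
    ∑[ t ← tests ] ∑[ G ← allGraphs k m ] w G t        ≤⟨ ∑≤length*c moment-bound ⟩
    length tests * (2 * (N * L ^ n))                   ≤⟨ *-monoˡ-≤ _ #tests≤2^Q ⟩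
    2 ^ Q * (2 * (N * L ^ n))                          ∎
  rarelyFailing : 200 * #bad ≤ N
  rarelyFailing = *-cancelˡ-≤ θ {{m*n≢0 (2 ^ (Q + 9)) (L ^ n) {{m^n≢0 2 (Q + 9)}} {{m^n≢0 L n}}}} (begin
    θ * (200 * #bad)                    ≡⟨ x∙yz≈y∙xz θ 200 #bad ⟩
    200 * (θ * #bad)                    ≤⟨ *-monoʳ-≤ 200 θ*#bad≤ ⟩
    200 * (2 ^ Q * (2 * (N * L ^ n)))   ≤⟨ 400≤512 (2 ^ Q) N (L ^ n) ⟩
    2 ^ Q * 2 ^ 9 * L ^ n * N           ≡⟨ cong (λ z → z * L ^ n * N) (sym (^-distribˡ-+-* 2 Q 9)) ⟩
    θ * N                               ∎)
    where
    x∙yz≈y∙xz : ∀ x y z → x * (y * z) ≡ y * (x * z)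
    x∙yz≈y∙xz = solve-∀
    400≤512 : ∀ x N p → 200 * (x * (2 * (N * p))) ≤ x * 2 ^ 9 * p * N
    400≤512 x N p = ≤-trans (m≤m+n _ (112 * (x * p * N))) (≤-reflexive (split x N p))
      where
      split : ∀ x N p → 200 * (x * (2 * (N * p))) + 112 * (x * p * N) ≡ x * 512 * p * N
      split = solve-∀

typically×typically⇒probAtLeast99/100 : ∀ {k m} {P R : BipGraph k m → Set} →
  Typically k m P → Typically k m R → ProbAtLeast k m (λ G → P G × R G) 99 100
typically×typically⇒probAtLeast99/100 {k} {m} typP typR =
  filter both? (allGraphs k m) , Unique.filter⁺ both? (allGraphs-unique k m) ,
  All.map (λ (goodP , goodR) → P.Good⇒P goodP , R.Good⇒P goodR) (all-filter both? (allGraphs k m)) ,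
  99N≤100·#good
  where
  module P = Typically typP
  module R = Typically typR
  open ≤-Reasoning
  both? : Decidable (λ G → P.Good G × R.Good G)
  both? G = P.good? G ×-dec R.good? G
  N = 2 ^ (k * m)
  #good = length (filter both? (allGraphs k m))
  #bad  = length (filter (¬? ∘ both?) (allGraphs k m))
  #badP = length (filter (¬? ∘ P.good?) (allGraphs k m))
  #badR = length (filter (¬? ∘ R.good?) (allGraphs k m))
  100·#bad≤N : 100 * #bad ≤ N
  100·#bad≤N = *-cancelˡ-≤ 2 (begin
    2 * (100 * #bad)           ≡⟨ sym (*-assoc 2 100 #bad) ⟩
    200 * #bad                 ≤⟨ *-monoʳ-≤ 200 (length-filter-¬×≤ P.good? R.good? (allGraphs k m)) ⟩
    200 * (#badP + #badR)      ≡⟨ *-distribˡ-+ 200 #badP #badR ⟩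
    200 * #badP + 200 * #badR  ≤⟨ +-mono-≤ P.rarelyFailing R.rarelyFailing ⟩
    N + N                      ≡⟨ cong (N +_) (sym (+-identityʳ N)) ⟩
    2 * N                      ∎)
  99N≤100·#good : 99 * N ≤ 100 * #good
  99N≤100·#good = +-cancelʳ-≤ N _ _ (begin
    99 * N + N                 ≡⟨ +-comm (99 * N) N ⟩
    100 * N                    ≡⟨ cong (100 *_) (sym (trans (length-filter+length-filter-¬ both? (allGraphs k m)) (length-allGraphs k m))) ⟩
    100 * (#good + #bad)       ≡⟨ *-distribˡ-+ 100 #good #bad ⟩
    100 * #good + 100 * #bad   ≤⟨ +-monoʳ-≤ (100 * #good) 100·#bad≤N ⟩
    100 * #good + N            ∎)

typically-allSubsetsBalanced : ∀ k m r Q (et : ExponentialTail m Q) → suc k ^ r ≤ 2 ^ Q →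
  Typically k m (λ G → All (λ S → ℤ.∣ sumU G S ∣ ≤ ExponentialTail.Δ et) (nonemptySubsetsOfSize≤ k r))
typically-allSubsetsBalanced k m r Q et [1+k]^r≤2^Q =
  typically-byMoments tests (λ G S → ℤ.∣ sumU G S ∣ ≤? Δ) w Q m L #tests≤2^Q moments ¬balanced⇒θ≤w
  where
  open ExponentialTail et
  a = up M
  b = down M
  L = mid M
  tests = nonemptySubsetsOfSize≤ k r
  w : BipGraph k m → Subset k → ℕ
  w G S = (∏[ j ← allFin m ] weight a b (uBit G S j)) + (∏[ j ← allFin m ] weight b a (uBit G S j))
  #tests≤2^Q : length tests ≤ 2 ^ Q
  #tests≤2^Q = ≤-trans (length-filter _ (subsetsOfSize≤ k r)) (≤-trans (length-subsetsOfSize≤ k r) [1+k]^r≤2^Q)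
  moment : ∀ S → 1 ≤ ∣ S ∣ → ∑[ G ← allGraphs k m ] w G S ≡ 2 * (2 ^ (k * m) * L ^ m)
  moment S S≢∅ = trans (∑-+ _ _ (allGraphs k m))
    (trans (cong₂ _+_ (∑-allGraphs-uWeight a b L k m S S≢∅ (up+down≡2*mid M))
                      (∑-allGraphs-uWeight b a L k m S S≢∅ (trans (+-comm b a) (up+down≡2*mid M))))
           (cong (2 ^ (k * m) * L ^ m +_) (sym (+-identityʳ _))))
  moments : All (λ S → ∑[ G ← allGraphs k m ] w G S ≤ 2 * (2 ^ (k * m) * L ^ m)) tests
  moments = All.map (λ {S} S≢∅ → ≤-reflexive (moment S S≢∅)) (all-filter (λ S → 1 ≤? ∣ S ∣) (subsetsOfSize≤ k r))
  ¬balanced⇒θ≤w : ∀ G S → ¬ ℤ.∣ sumU G S ∣ ≤ Δ → 2 ^ (Q + 9) * L ^ m ≤ w G S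
  ¬balanced⇒θ≤w G S unbalanced =
    θ≤w (∣+p-+q∣>Δ⇒ p q Δ (subst (λ z → ¬ ℤ.∣ z ∣ ≤ Δ) (sumU≡countTrue-countFalse G S) unbalanced))
    where
    p = countTrue (uBit G S) (allFin m)
    q = countFalse (uBit G S) (allFin m)
    p+q≡m : p + q ≡ m
    p+q≡m = trans (countTrue+countFalse≡length (uBit G S) (allFin m)) (length-allFin m)
    θ≤w : q + Δ < p ⊎ p + Δ < q → 2 ^ (Q + 9) * L ^ m ≤ w G S
    θ≤w (inj₁ q+Δ<p) = ≤-trans (tail p q p+q≡m q+Δ<p)
      (≤-trans (≤-reflexive (sym (∏-weight a b (uBit G S) (allFin m)))) (m≤m+n _ _))
    θ≤w (inj₂ p+Δ<q) = ≤-trans (tail q p (trans (+-comm q p) p+q≡m) p+Δ<q)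
      (≤-trans (≤-reflexive (trans (*-comm (a ^ q) (b ^ p)) (sym (∏-weight b a (uBit G S) (allFin m))))) (m≤n+m _ _))

typically-allDegreesBounded : ∀ k m Q (et : ExponentialTail k Q) → m ≤ 2 ^ Q →
  Typically k m (λ G → All (λ j → 2 * degV G j ≤ k + ExponentialTail.Δ et) (allFin m))
typically-allDegreesBounded k m Q et m≤2^Q =
  typically-byMoments (allFin m) (λ G j → 2 * degV G j ≤? k + Δ) w Q k L
    (≤-trans (≤-reflexive (length-allFin m)) m≤2^Q) moments ¬bounded⇒θ≤w
  where
  open ExponentialTail et
  a = up M
  b = down M
  L = mid M
  w : BipGraph k m → Fin m → ℕ
  w G j = ∏[ i ← allFin k ] weight a b (edge G i j)
  moments : All (λ j → ∑[ G ← allGraphs k m ] w G j ≤ 2 * (2 ^ (k * m) * L ^ k)) (allFin m)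
  moments = All.universal (λ j → ≤-trans (≤-reflexive (∑-allGraphs-columnWeight a b L k m j (up+down≡2*mid M))) (m≤m+n _ _)) (allFin m)
  ¬bounded⇒θ≤w : ∀ G j → ¬ 2 * degV G j ≤ k + Δ → 2 ^ (Q + 9) * L ^ k ≤ w G j
  ¬bounded⇒θ≤w G j unbounded = ≤-trans (tail p q p+q≡k q+Δ<p) (≤-reflexive (sym (∏-weight a b (λ i → edge G i j) (allFin k))))
    where
    open ≤-Reasoning
    p = degV G j
    q = countFalse (λ i → edge G i j) (allFin k)
    p+q≡k : p + q ≡ k
    p+q≡k = trans (countTrue+countFalse≡length (λ i → edge G i j) (allFin k)) (length-allFin k)
    q+Δ<p : q + Δ < p
    q+Δ<p = +-cancelˡ-≤ p _ _ (begin
      p + suc (q + Δ) ≡⟨ +-suc p (q + Δ) ⟩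
      suc (p + (q + Δ)) ≡⟨ cong suc (sym (+-assoc p q Δ)) ⟩
      suc (p + q + Δ) ≡⟨ cong (λ n → suc (n + Δ)) p+q≡k ⟩
      suc (k + Δ) ≤⟨ ≰⇒> unbounded ⟩
      2 * p ≡⟨ cong (p +_) (+-identityʳ p) ⟩
      p + p ∎)

x*Q≤484*Q*x : ∀ x Q → x * Q ≤ 484 * Q * x
x*Q≤484*Q*x x Q = ≤-trans (m≤m+n (x * Q) (483 * (x * Q))) (≤-reflexive (lemma x Q))
  where
  lemma : ∀ x Q → x * Q + 483 * (x * Q) ≡ 484 * Q * x
  lemma = solve-∀

484[lr]m≤484r[k+m]l : ∀ k m r l → 484 * (l * r) * m ≤ 484 * r * (k + m) * l
484[lr]m≤484r[k+m]l k m r l = ≤-trans (*-monoʳ-≤ (484 * (l * r)) (m≤n+m m k)) (≤-reflexive (lemma k m r l))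
  where
  lemma : ∀ k m r l → 484 * (l * r) * (k + m) ≡ 484 * r * (k + m) * l
  lemma = solve-∀

Balanced : ∀ {k m} → ℕ → ℕ → BipGraph k m → Set
Balanced {k} {m} r l G = Σ ℕ λ Δ → HasBalancedness G r Δ × Δ * Δ ≤ 484 * r * (k + m) * l

DegreeBounded : ∀ {k m} → ℕ → BipGraph k m → Set
DegreeBounded {k} {m} l G = Σ ℕ λ D → D * D ≤ 484 * k * l × ((j : Fin m) → 2 * degV G j ≤ k + D)

typically-balanced : ∀ k m r l → r ≤ k → k < 2 ^ l → Typically k m (Balanced r l)
typically-balanced k m zero    l _ _ =
  typically-always (λ G → 0 , (λ S 1≤∣S∣ ∣S∣≤0 → contradiction (≤-trans 1≤∣S∣ ∣S∣≤0) λ ()) , z≤n)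
typically-balanced k m (suc r) l 1+r≤k k<2^l with m ≤? l * suc r
... | yes m≤Q = typically-always (λ G → m , (λ S _ _ → ∣sumU∣≤m G S) ,
        ≤-trans (*-monoʳ-≤ m m≤Q) (≤-trans (x*Q≤484*Q*x m (l * suc r)) (484[lr]m≤484r[k+m]l k m (suc r) l)))
... | no  m≰Q = typically-mono good⇒balanced (typically-allSubsetsBalanced k m (suc r) Q et [1+k]^[1+r]≤2^Q)
  where
  Q = l * suc r
  1≤Q : 1 ≤ Q
  1≤Q = *-mono-≤ {1} {l} {1} {suc r} (1<2^l⇒1≤l (≤-trans (s≤s (≤-trans (s≤s z≤n) 1+r≤k)) k<2^l)) (s≤s z≤n)
  et = exponentialTail m Q 1≤Q (<⇒≤ (≰⇒> m≰Q))
  open ExponentialTail et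
  [1+k]^[1+r]≤2^Q : suc k ^ suc r ≤ 2 ^ Q
  [1+k]^[1+r]≤2^Q = ≤-trans (^-monoˡ-≤ (suc r) k<2^l) (≤-reflexive (^-*-assoc 2 l (suc r)))
  good⇒balanced : ∀ G → All (λ S → ℤ.∣ sumU G S ∣ ≤ Δ) (nonemptySubsetsOfSize≤ k (suc r)) → Balanced (suc r) l G
  good⇒balanced G good = Δ ,
    (λ S 1≤∣S∣ ∣S∣≤1+r → All.lookup good (∈-filter⁺ (λ S → 1 ≤? ∣ S ∣) (∈-subsetsOfSize≤ k (suc r) S ∣S∣≤1+r) 1≤∣S∣)) ,
    ≤-trans Δ²≤484Qn (484[lr]m≤484r[k+m]l k m (suc r) l)

typically-degreeBounded : ∀ k m l → k + m < 2 ^ l → Typically k m (DegreeBounded l)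
typically-degreeBounded k m l k+m<2^l with k ≤? l
... | yes k≤l = typically-always (λ G → k , ≤-trans (*-monoʳ-≤ k k≤l) (≤-trans (x*Q≤484*Q*x k l) (≤-reflexive (*-comm-484 k l))) ,
        λ j → ≤-trans (*-monoʳ-≤ 2 (degV≤k G j)) (≤-reflexive (cong (k +_) (+-identityʳ k))))
  where
  *-comm-484 : ∀ k l → 484 * l * k ≡ 484 * k * l
  *-comm-484 = solve-∀
  degV≤k : ∀ G j → degV G j ≤ k
  degV≤k G j = ≤-trans (m≤m+n _ _) (≤-reflexive (trans (countTrue+countFalse≡length (λ i → edge G i j) (allFin k)) (length-allFin k)))
... | no  k≰l = typically-mono good⇒bounded (typically-allDegreesBounded k m l et m≤2^l)
  where
  l<k : l < k
  l<k = ≰⇒> k≰l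
  1≤l : 1 ≤ l
  1≤l = 1<2^l⇒1≤l (≤-trans (s≤s (≤-trans (≤-trans (s≤s z≤n) l<k) (m≤m+n k m))) k+m<2^l)
  et = exponentialTail k l 1≤l (<⇒≤ l<k)
  open ExponentialTail et
  m≤2^l : m ≤ 2 ^ l
  m≤2^l = ≤-trans (m≤n+m m k) (<⇒≤ k+m<2^l)
  good⇒bounded : ∀ G → All (λ j → 2 * degV G j ≤ k + Δ) (allFin m) → DegreeBounded l G
  good⇒bounded G good = Δ , ≤-trans Δ²≤484Qn (≤-reflexive (*-comm-484 l k)) , λ j → All.lookup good (∈-allFin j)
    where
    *-comm-484 : ∀ l k → 484 * l * k ≡ 484 * k * l
    *-comm-484 = solve-∀

mainTheorem8 : Σ ℕ λ C → (k m r : ℕ) → r ≤ k →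
  ProbAtLeast k m
    (λ G → (Σ ℕ λ Δ → HasBalancedness G r Δ × Δ * Δ ≤ C * r * (k + m) * lg k)
         × (Σ ℕ λ D → D * D ≤ C * k * lg (k + m)
              × ((j : Fin m) → 2 * degV G j ≤ k + D)))
    99 100
mainTheorem8 = 484 , λ k m r r≤k → typically×typically⇒probAtLeast99/100
  (typically-balanced k m r (lg k) r≤k (n<2^lg k))
  (typically-degreeBounded k m (lg (k + m)) (n<2^lg (k + m)))
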